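{- Let $m$ be a positive integer that is not a power of two, and let $\{G_n^*(x)\}$ be a generalized Fibonacci polynomial sequence of Lucas type. Then for every odd divisor $q$ of $m$, the polynomial $G^*_{m/q}(x)$ (itself a term of the same Lucas-type sequence) divides $G^*_m(x)$.
   Context: All polynomials lie in $\mathbb{Z}[x]$. A generalized Fibonacci polynomial (GFP) sequence $\{G_n(x)\}_{n\ge0}$ is given by $G_0(x)=p_0(x)$, $G_1(x)=p_1(x)$ and $G_n(x)=d(x)G_{n-1}(x)+g(x)G_{n-2}(x)$ for $n\ge 2$, where $p_0(x)$ is a constant and $p_1(x),d(x),g(x)$ are nonzero polynomials in $\mathbb{Z}[x]$ with $\gcd(d(x),g(x))=1$; as in the paper it is assumed that $d(x)^2+4g(x)>0$. Let $a,b$ be the roots of $z^2-d(x)z-g(x)=0$. The sequence is of Lucas type if $p_0\ne 0$, $2p_1(x)=p_0\,d(x)$, $|p_0|\in\{1,2\}$, and $\gcd(p_0,p_1(x))=\gcd(p_0,d(x))=\gcd(p_0,g(x))=1$; then, with $\alpha=2/p_0$, $G_n=(a^n+b^n)/\alpha$ (denoted $G_n^*$). -}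

module Defs where

open import Data.Nat using (ℕ; zero; suc)
open import Data.Integer using (ℤ; +_; _+_; _*_; ∣_∣; _>_)
open import Data.List using (List; []; _∷_)
open import Data.Product using (∃; Σ)
open import Data.Sum using (_⊎_)
open import Relation.Binary.PropositionalEquality using (_≡_)
open import Relation.Nullary using (¬_)

-- Polynomials in ℤ[x], as coefficient lists (constant term first).
Poly : Set
Poly = List ℤ

coeff : Poly → ℕ → ℤ
coeff []      _       = + 0
coeff (a ∷ p) zero    = a
coeff (a ∷ p) (suc i) = coeff p i

infix 4 _≈ₚ_
_≈ₚ_ : Poly → Poly → Set
p ≈ₚ q = ∀ i → coeff p i ≡ coeff q i

const : ℤ → Poly
const c = c ∷ []

infixl 6 _+ₚ_
_+ₚ_ : Poly → Poly → Poly
[]      +ₚ q       = q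
(a ∷ p) +ₚ []      = a ∷ p
(a ∷ p) +ₚ (b ∷ q) = (a + b) ∷ (p +ₚ q)

scale : ℤ → Poly → Poly
scale c []      = []
scale c (a ∷ p) = (c * a) ∷ scale c p

infixl 7 _*ₚ_
_*ₚ_ : Poly → Poly → Poly
[]      *ₚ q = []
(a ∷ p) *ₚ q = scale a q +ₚ (+ 0 ∷ (p *ₚ q))

eval : Poly → ℤ → ℤ
eval []      x = + 0
eval (a ∷ p) x = a + x * eval p x

infix 4 _∣ₚ_
_∣ₚ_ : Poly → Poly → Set
p ∣ₚ q = ∃ λ r → q ≈ₚ p *ₚ r

CoprimeP : Poly → Poly → Set
CoprimeP p q = ∀ c → c ∣ₚ p → c ∣ₚ q → c ∣ₚ const (+ 1)

NonZeroP : Poly → Set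
NonZeroP p = ¬ (p ≈ₚ [])

GFP : ℤ → Poly → Poly → Poly → ℕ → Poly
GFP p0 p1 d g zero            = const p0
GFP p0 p1 d g (suc zero)      = p1
GFP p0 p1 d g (suc (suc n))   = d *ₚ GFP p0 p1 d g (suc n) +ₚ g *ₚ GFP p0 p1 d g n

-- Standing assumptions on the data (p1, d, g nonzero, gcd(d,g)=1,
-- d² + 4g > 0, read as: positive at every integer argument).
record GFPData (p0 : ℤ) (p1 d g : Poly) : Set where
  field
    p1≠0   : NonZeroP p1
    d≠0    : NonZeroP d
    g≠0    : NonZeroP g
    coprime-dg : CoprimeP d g
    disc>0 : ∀ (x : ℤ) → eval (d *ₚ d +ₚ scale (+ 4) g) x > + 0

record LucasType (p0 : ℤ) (p1 d g : Poly) : Set where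
  field
    p0≠0   : ¬ (p0 ≡ + 0)
    two-p1 : scale (+ 2) p1 ≈ₚ scale p0 d
    abs-p0 : ∣ p0 ∣ ≡ 1 ⊎ ∣ p0 ∣ ≡ 2
    coprime-p0-p1 : CoprimeP (const p0) p1
    coprime-p0-d  : CoprimeP (const p0) d
    coprime-p0-g  : CoprimeP (const p0) g

{-# OPTIONS --safe #-}
module Submission where

-- Let L be the Lucas sequence of the recurrence (L₀ = 2, L₁ = d). Every
-- solution G of the recurrence satisfies L_k G_{n+k} = G_{n+2k} + (-g)^k G_n.
-- For a Lucas-type sequence p₀ L_n = 2 G_n with p₀ ∣ 2, so G_k ∣ L_k, and
-- G_{k(q+2)} = L_k G_{k(q+1)} - (-g)^k G_{kq} gives G_k ∣ G_{kq} for odd q by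
-- induction.

open import Defs

module IntegerPolynomials where

  open import Algebra.Bundles using (CommutativeRing)
  open import Data.Integer using (+_; -_; _+_; _*_; NonZero)
  import Data.Integer.Properties as ℤ
  open import Data.Integer.Divisibility.Signed using (_∣_; divides; quotient)
  open import Data.List using ([]; _∷_)
  open import Data.Maybe using (Maybe; just; nothing; map)
  open import Data.Nat using (zero; suc)
  open import Data.Product using (_,_)
  open import Level using (0ℓ)
  open import Relation.Binary.PropositionalEquality
    using (_≡_; refl; sym; trans; cong; cong₂; module ≡-Reasoning)

  coeff-+ₚ : ∀ p q i → coeff (p +ₚ q) i ≡ coeff p i + coeff q i
  coeff-+ₚ []      q       i       = sym (ℤ.+-identityˡ _)
  coeff-+ₚ (a ∷ p) []      i       = sym (ℤ.+-identityʳ _)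
  coeff-+ₚ (a ∷ p) (b ∷ q) zero    = refl
  coeff-+ₚ (a ∷ p) (b ∷ q) (suc i) = coeff-+ₚ p q i

  coeff-scale : ∀ c p i → coeff (scale c p) i ≡ c * coeff p i
  coeff-scale c []      i       = sym (ℤ.*-zeroʳ c)
  coeff-scale c (a ∷ p) zero    = refl
  coeff-scale c (a ∷ p) (suc i) = coeff-scale c p i

  -- A record rather than the function type p ≈ₚ q, so that p and q can be
  -- inferred from a proof of p ≋ q.
  infix 4 _≋_
  record _≋_ (p q : Poly) : Set where
    constructor coeffwise
    field coeff-≡ : p ≈ₚ q
  open _≋_ public

  ≋-refl : ∀ {p} → p ≋ p
  ≋-refl = coeffwise λ _ → refl

  ≋-sym : ∀ {p q} → p ≋ q → q ≋ p
  ≋-sym (coeffwise e) = coeffwise λ i → sym (e i)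

  ≋-trans : ∀ {p q r} → p ≋ q → q ≋ r → p ≋ r
  ≋-trans (coeffwise e) (coeffwise f) = coeffwise λ i → trans (e i) (f i)

  ∷-cong : ∀ {a b p q} → a ≡ b → p ≋ q → a ∷ p ≋ b ∷ q
  ∷-cong {a} {b} {p} {q} a≡b (coeffwise e) = coeffwise coeff-≡′
    where
    coeff-≡′ : a ∷ p ≈ₚ b ∷ q
    coeff-≡′ zero    = a≡b
    coeff-≡′ (suc i) = e i

  []≋0∷ : ∀ {p} → [] ≋ p → [] ≋ + 0 ∷ p
  []≋0∷ {p} (coeffwise e) = coeffwise coeff-≡′
    where
    coeff-≡′ : [] ≈ₚ + 0 ∷ p
    coeff-≡′ zero    = refl
    coeff-≡′ (suc i) = e i

  +ₚ-cong : ∀ {p p′ q q′} → p ≋ p′ → q ≋ q′ → p +ₚ q ≋ p′ +ₚ q′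
  +ₚ-cong {p} {p′} {q} {q′} (coeffwise e) (coeffwise f) = coeffwise λ i →
    trans (coeff-+ₚ p q i) (trans (cong₂ _+_ (e i) (f i)) (sym (coeff-+ₚ p′ q′ i)))

  scale-cong : ∀ c {p q} → p ≋ q → scale c p ≋ scale c q
  scale-cong c {p} {q} (coeffwise e) = coeffwise λ i →
    trans (coeff-scale c p i) (trans (cong (c *_) (e i)) (sym (coeff-scale c q i)))

  +ₚ-identityʳ : ∀ p → p +ₚ [] ≋ p
  +ₚ-identityʳ []      = ≋-refl
  +ₚ-identityʳ (a ∷ p) = ≋-refl

  +ₚ-assoc : ∀ p q r → (p +ₚ q) +ₚ r ≋ p +ₚ (q +ₚ r)
  +ₚ-assoc p q r = coeffwise assoc
    where
    assoc : (p +ₚ q) +ₚ r ≈ₚ p +ₚ (q +ₚ r)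
    assoc i rewrite coeff-+ₚ (p +ₚ q) r i | coeff-+ₚ p q i
                  | coeff-+ₚ p (q +ₚ r) i | coeff-+ₚ q r i
      = ℤ.+-assoc (coeff p i) (coeff q i) (coeff r i)

  +ₚ-comm : ∀ p q → p +ₚ q ≋ q +ₚ p
  +ₚ-comm p q = coeffwise comm
    where
    comm : p +ₚ q ≈ₚ q +ₚ p
    comm i rewrite coeff-+ₚ p q i | coeff-+ₚ q p i = ℤ.+-comm (coeff p i) (coeff q i)

  +ₚ-left-comm : ∀ p q r → p +ₚ (q +ₚ r) ≋ q +ₚ (p +ₚ r)
  +ₚ-left-comm p q r = ≋-trans (≋-sym (+ₚ-assoc p q r))
    (≋-trans (+ₚ-cong (+ₚ-comm p q) ≋-refl) (+ₚ-assoc q p r))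

  +ₚ-interchange : ∀ w x y z → (w +ₚ x) +ₚ (y +ₚ z) ≋ (w +ₚ y) +ₚ (x +ₚ z)
  +ₚ-interchange w x y z = ≋-trans (+ₚ-assoc w x (y +ₚ z))
    (≋-trans (+ₚ-cong (≋-refl {w}) (+ₚ-left-comm x y z)) (≋-sym (+ₚ-assoc w y (x +ₚ z))))

  -ₚ_ : Poly → Poly
  -ₚ_ = scale (- + 1)

  +ₚ-inverseˡ : ∀ p → (-ₚ p) +ₚ p ≋ []
  +ₚ-inverseˡ p = coeffwise inverse
    where
    inverse : (-ₚ p) +ₚ p ≈ₚ []
    inverse i rewrite coeff-+ₚ (-ₚ p) p i | coeff-scale (- + 1) p i | ℤ.-1*i≡-i (coeff p i)
      = ℤ.+-inverseˡ (coeff p i)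

  scale-+ₚ : ∀ c p q → scale c (p +ₚ q) ≋ scale c p +ₚ scale c q
  scale-+ₚ c p q = coeffwise distrib
    where
    distrib : scale c (p +ₚ q) ≈ₚ scale c p +ₚ scale c q
    distrib i rewrite coeff-scale c (p +ₚ q) i | coeff-+ₚ p q i
                    | coeff-+ₚ (scale c p) (scale c q) i | coeff-scale c p i | coeff-scale c q i
      = ℤ.*-distribˡ-+ c (coeff p i) (coeff q i)

  scale-scale : ∀ a b p → scale (a * b) p ≋ scale a (scale b p)
  scale-scale a b []      = ≋-refl
  scale-scale a b (c ∷ p) = ∷-cong (ℤ.*-assoc a b c) (scale-scale a b p)

  scale-zero : ∀ p → scale (+ 0) p ≋ []
  scale-zero p = coeffwise λ i → coeff-scale (+ 0) p i

  scale-one : ∀ p → scale (+ 1) p ≋ p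
  scale-one []      = ≋-refl
  scale-one (a ∷ p) = ∷-cong (ℤ.*-identityˡ a) (scale-one p)

  const-*ₚ : ∀ c p → const c *ₚ p ≋ scale c p
  const-*ₚ c p =
    ≋-trans (+ₚ-cong (≋-refl {scale c p}) (≋-sym ([]≋0∷ ≋-refl))) (+ₚ-identityʳ (scale c p))

  *ₚ-congʳ : ∀ p {q q′} → q ≋ q′ → p *ₚ q ≋ p *ₚ q′
  *ₚ-congʳ []      e = ≋-refl
  *ₚ-congʳ (a ∷ p) e = +ₚ-cong (scale-cong a e) (∷-cong refl (*ₚ-congʳ p e))

  *ₚ-zeroʳ : ∀ p → p *ₚ [] ≋ []
  *ₚ-zeroʳ []      = ≋-refl
  *ₚ-zeroʳ (a ∷ p) = ≋-sym ([]≋0∷ (≋-sym (*ₚ-zeroʳ p)))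

  *ₚ-∷ʳ : ∀ q a p → q *ₚ (a ∷ p) ≋ scale a q +ₚ (+ 0 ∷ q *ₚ p)
  *ₚ-∷ʳ []      a p = []≋0∷ ≋-refl
  *ₚ-∷ʳ (b ∷ q) a p = ∷-cong (cong (_+ + 0) (ℤ.*-comm b a))
    (≋-trans (+ₚ-cong (≋-refl {scale b p}) (*ₚ-∷ʳ q a p))
             (+ₚ-left-comm (scale b p) (scale a q) (+ 0 ∷ q *ₚ p)))

  *ₚ-comm : ∀ p q → p *ₚ q ≋ q *ₚ p
  *ₚ-comm []      q = ≋-sym (*ₚ-zeroʳ q)
  *ₚ-comm (a ∷ p) q = ≋-trans (+ₚ-cong (≋-refl {scale a q}) (∷-cong refl (*ₚ-comm p q)))
    (≋-sym (*ₚ-∷ʳ q a p))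

  *ₚ-congˡ : ∀ {p p′} q → p ≋ p′ → p *ₚ q ≋ p′ *ₚ q
  *ₚ-congˡ {p} {p′} q e = ≋-trans (*ₚ-comm p q) (≋-trans (*ₚ-congʳ q e) (*ₚ-comm q p′))

  *ₚ-distribˡ : ∀ p q r → p *ₚ (q +ₚ r) ≋ p *ₚ q +ₚ p *ₚ r
  *ₚ-distribˡ []      q r = ≋-refl
  *ₚ-distribˡ (a ∷ p) q r =
    ≋-trans (+ₚ-cong (scale-+ₚ a q r) (∷-cong refl (*ₚ-distribˡ p q r)))
            (+ₚ-interchange (scale a q) (scale a r) (+ 0 ∷ p *ₚ q) (+ 0 ∷ p *ₚ r))

  *ₚ-distribʳ : ∀ r p q → (p +ₚ q) *ₚ r ≋ p *ₚ r +ₚ q *ₚ r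
  *ₚ-distribʳ r p q = ≋-trans (*ₚ-comm (p +ₚ q) r)
    (≋-trans (*ₚ-distribˡ r p q) (+ₚ-cong (*ₚ-comm r p) (*ₚ-comm r q)))

  scale-*ₚ : ∀ a q r → scale a q *ₚ r ≋ scale a (q *ₚ r)
  scale-*ₚ a []      r = ≋-refl
  scale-*ₚ a (b ∷ q) r = ≋-sym (≋-trans (scale-+ₚ a (scale b r) (+ 0 ∷ q *ₚ r))
    (+ₚ-cong (≋-sym (scale-scale a b r)) (∷-cong (ℤ.*-zeroʳ a) (≋-sym (scale-*ₚ a q r)))))

  0∷-*ₚ : ∀ p q → (+ 0 ∷ p) *ₚ q ≋ + 0 ∷ p *ₚ q
  0∷-*ₚ p q = +ₚ-cong (scale-zero q) ≋-refl

  *ₚ-assoc : ∀ p q r → (p *ₚ q) *ₚ r ≋ p *ₚ (q *ₚ r)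
  *ₚ-assoc []      q r = ≋-refl
  *ₚ-assoc (a ∷ p) q r = ≋-trans (*ₚ-distribʳ r (scale a q) (+ 0 ∷ p *ₚ q))
    (+ₚ-cong (scale-*ₚ a q r) (≋-trans (0∷-*ₚ (p *ₚ q) r) (∷-cong refl (*ₚ-assoc p q r))))

  ℤ[x] : CommutativeRing 0ℓ 0ℓ
  ℤ[x] = record
    { Carrier = Poly
    ; _≈_ = _≋_
    ; _+_ = _+ₚ_
    ; _*_ = _*ₚ_
    ; -_ = -ₚ_
    ; 0# = []
    ; 1# = const (+ 1)
    ; isCommutativeRing = record
      { isRing = record
        { +-isAbelianGroup = record
          { isGroup = record
            { isMonoid = record
              { isSemigroup = record
                { isMagma = record
                  { isEquivalence = record { refl = ≋-refl ; sym = ≋-sym ; trans = ≋-trans }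
                  ; ∙-cong = +ₚ-cong }
                ; assoc = +ₚ-assoc }
              ; identity = (λ _ → ≋-refl) , +ₚ-identityʳ }
            ; inverse = +ₚ-inverseˡ , λ p → ≋-trans (+ₚ-comm p (-ₚ p)) (+ₚ-inverseˡ p)
            ; ⁻¹-cong = scale-cong (- + 1) }
          ; comm = +ₚ-comm }
        ; *-cong = λ {p} {p′} {q} {q′} e f → ≋-trans (*ₚ-congˡ q e) (*ₚ-congʳ p′ f)
        ; *-assoc = *ₚ-assoc
        ; *-identity = (λ p → ≋-trans (const-*ₚ (+ 1) p) (scale-one p))
                     , (λ p → ≋-trans (*ₚ-comm p _) (≋-trans (const-*ₚ (+ 1) p) (scale-one p)))
        ; distrib = *ₚ-distribˡ , *ₚ-distribʳ }
      ; *-comm = *ₚ-comm } }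

  0≟ : ∀ p → Maybe ([] ≋ p)
  0≟ []          = just ≋-refl
  0≟ (+ 0 ∷ p)   = map []≋0∷ (0≟ p)
  0≟ (_ ∷ _)     = nothing

  scale-cancel : ∀ {a b} .{{_ : NonZero a}} (a∣b : a ∣ b) p q →
                 scale a p ≋ scale b q → p ≋ scale (quotient a∣b) q
  scale-cancel {a} {b} (divides c b≡ca) p q (coeffwise e) = coeffwise λ i →
    trans (ℤ.*-cancelˡ-≡ a _ _ (a-multiple i)) (sym (coeff-scale c q i))
    where
    open ≡-Reasoning
    a-multiple : ∀ i → a * coeff p i ≡ a * (c * coeff q i)
    a-multiple i = begin
      a * coeff p i        ≡⟨ coeff-scale a p i ⟨
      coeff (scale a p) i  ≡⟨ e i ⟩
      coeff (scale b q) i  ≡⟨ coeff-scale b q i ⟩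
      b * coeff q i        ≡⟨ cong (_* coeff q i) b≡ca ⟩
      c * a * coeff q i    ≡⟨ cong (_* coeff q i) (ℤ.*-comm c a) ⟩
      a * c * coeff q i    ≡⟨ ℤ.*-assoc a c (coeff q i) ⟩
      a * (c * coeff q i)  ∎

  open import Algebra.Definitions.RawMagma (CommutativeRing.*-rawMagma ℤ[x]) as ℤ[x] using (_,_)

  ∣⇒∣ₚ : ∀ {p q} → p ℤ[x].∣ q → p ∣ₚ q
  ∣⇒∣ₚ {p} (r , r*p≋q) = r , λ i → trans (sym (coeff-≡ r*p≋q i)) (coeff-≡ (*ₚ-comm r p) i)

-- Only the ring solver, which needs a decidable zero test, ties this module to
-- ℤ[x] rather than an arbitrary commutative ring.
module LinearRecurrences (d g : Poly) where

  open IntegerPolynomials using (ℤ[x]; 0≟; coeffwise; const-*ₚ; scale-cancel)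
  open import Algebra.Bundles using (CommutativeRing; Semiring)
  open CommutativeRing ℤ[x]
  open import Algebra.Definitions.RawSemiring (Semiring.rawSemiring semiring) using (_^_)
  open import Algebra.Properties.Magma.Divisibility *-magma using (∣ʳ-respʳ-≈)
  open import Algebra.Properties.Monoid.Divisibility *-monoid using (∣ʳ-reflexive)
  open import Algebra.Properties.Semigroup.Divisibility *-semigroup using (x∣ʳy⇒x∣ʳzy)
  open import Data.Nat as ℕ using (ℕ; zero; suc)
  import Data.Nat.Properties as ℕ
  open import Data.Nat.Divisibility as ℕ using ()
  open import Data.Integer as ℤ using (+_; ≢-nonZero)
  open import Data.Integer.Divisibility.Signed as ℤ using (quotient; ∣ᵤ⇒∣)
  open import Data.Sum using ([_,_])
  open import Algebra.Definitions.RawMagma *-rawMagma using (_∣_; _,_)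
  open import Function using (_∘_)
  open import Relation.Binary.PropositionalEquality as ≡ using (_≡_)
  open import Relation.Nullary using (¬_; contradiction)
  open import Relation.Binary.Reasoning.Setoid setoid
  open import Tactic.RingSolver.Core.AlmostCommutativeRing using (fromCommutativeRing)
  open import Tactic.RingSolver.NonReflective (fromCommutativeRing ℤ[x] 0≟)

  Recurrent : (ℕ → Poly) → Set
  Recurrent G = ∀ n → G (suc (suc n)) ≈ d * G (suc n) + g * G n

  -- lucas n = aⁿ + bⁿ, that is α G*ₙ in the paper's notation.
  lucas : ℕ → Poly
  lucas zero          = 1# + 1#
  lucas (suc zero)    = d
  lucas (suc (suc n)) = d * lucas (suc n) + g * lucas n

  lucas-recurrent : Recurrent lucas
  lucas-recurrent _ = refl

  GFP-recurrent : ∀ p0 p1 → Recurrent (GFP p0 p1 d g)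
  GFP-recurrent p0 p1 _ = refl

  shift-recurrent : ∀ {G} n → Recurrent G → Recurrent (λ m → G (m ℕ.+ n))
  shift-recurrent n rec m = rec (m ℕ.+ n)

  *-recurrent : ∀ {G} a → Recurrent G → Recurrent (λ n → a * G n)
  *-recurrent {G} a rec n = begin
    a * G (suc (suc n))                   ≈⟨ *-congˡ {a} (rec n) ⟩
    a * (d * G (suc n) + g * G n)
      ≈⟨ solve 5 (λ a d g y x → a ⊗ (d ⊗ y ⊕ g ⊗ x) ⊜ (d ⊗ (a ⊗ y) ⊕ g ⊗ (a ⊗ x)))
                 refl a d g (G (suc n)) (G n) ⟩
    d * (a * G (suc n)) + g * (a * G n)   ∎

  recurrent-unique : ∀ {F H} → Recurrent F → Recurrent H →
                     F 0 ≈ H 0 → F 1 ≈ H 1 → ∀ n → F n ≈ H n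
  recurrent-unique F-rec H-rec e₀ e₁ zero          = e₀
  recurrent-unique F-rec H-rec e₀ e₁ (suc zero)    = e₁
  recurrent-unique {F} {H} F-rec H-rec e₀ e₁ (suc (suc n)) =
    trans (F-rec n) (trans (+-cong (*-congˡ {d} (F≈H (suc n))) (*-congˡ {g} (F≈H n)))
                           (sym (H-rec n)))
    where
    F≈H : ∀ n → F n ≈ H n
    F≈H = recurrent-unique F-rec H-rec e₀ e₁

  lucas-product : ∀ {G} → Recurrent G → ∀ k → G (k ℕ.+ k) + (- g) ^ k * G 0 ≈ lucas k * G k
  lucas-product {G} rec zero = solve 1 (λ x → x ⊕ Κ 1# ⊗ x ⊜ (Κ 1# ⊕ Κ 1#) ⊗ x) refl (G 0)
  lucas-product {G} rec (suc zero) = begin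
    G 2 + (- g) * 1# * G 0                 ≈⟨ +-congʳ {(- g) * 1# * G 0} (rec 0) ⟩
    d * G 1 + g * G 0 + (- g) * 1# * G 0
      ≈⟨ solve 4 (λ d g y x → d ⊗ y ⊕ g ⊗ x ⊕ (⊝ g) ⊗ Κ 1# ⊗ x ⊜ d ⊗ y) refl d g (G 1) (G 0) ⟩
    d * G 1                                ∎
  -- The two previous cases are used for G shifted by one and by two.
  lucas-product {G} rec (suc (suc k)) = begin
    G (suc (suc k) ℕ.+ suc (suc k)) + (- g) * ((- g) * c) * G 0
      ≈⟨ +-congʳ {c″G₀} (trans (reflexive (≡.cong G (double-suc (suc k)))) (rec _)) ⟩
    d * Y + g * G (suc (k ℕ.+ suc k)) + (- g) * ((- g) * c) * G 0
      ≈⟨ +-congʳ {c″G₀} (+-congˡ {d * Y} (*-congˡ {g} (reflexive (≡.cong G (double-suc k))))) ⟩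
    d * Y + g * X + (- g) * ((- g) * c) * G 0
      ≈⟨ solve 7 (λ d g c y x g₁ g₀ → d ⊗ y ⊕ g ⊗ x ⊕ (⊝ g) ⊗ ((⊝ g) ⊗ c) ⊗ g₀
                    ⊜ (d ⊗ (y ⊕ (⊝ g) ⊗ c ⊗ g₁) ⊕ g ⊗ (x ⊕ c ⊗ (d ⊗ g₁ ⊕ g ⊗ g₀))))
                 refl d g c Y X (G 1) (G 0) ⟩
    d * (Y + (- g) * c * G 1) + g * (X + c * (d * G 1 + g * G 0))
      ≈⟨ +-congˡ {d * (Y + (- g) * c * G 1)}
                 (*-congˡ {g} (+-congˡ {X} (*-congˡ {c} (sym (rec 0))))) ⟩
    d * (Y + (- g) * c * G 1) + g * (X + c * G 2)
      ≈⟨ +-cong (*-congˡ {d} (lucas-product (rec ∘ suc) (suc k)))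
                (*-congˡ {g} (lucas-product (rec ∘ suc ∘ suc) k)) ⟩
    d * (lucas (suc k) * W) + g * (lucas k * W)
      ≈⟨ solve 5 (λ d g a b w → d ⊗ (a ⊗ w) ⊕ g ⊗ (b ⊗ w) ⊜ (d ⊗ a ⊕ g ⊗ b) ⊗ w)
                 refl d g (lucas (suc k)) (lucas k) W ⟩
    (d * lucas (suc k) + g * lucas k) * W  ∎
    where
    c c″G₀ Y X W : Poly
    c = (- g) ^ k
    c″G₀ = (- g) * ((- g) * c) * G 0
    Y = G (suc (suc (k ℕ.+ suc k)))
    X = G (suc (suc (k ℕ.+ k)))
    W = G (suc (suc k))
    double-suc : ∀ m → suc m ℕ.+ suc m ≡ suc (suc (m ℕ.+ m))
    double-suc m = ≡.cong suc (ℕ.+-suc m m)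

  ∣-+ : ∀ {x y z} → x ∣ y → x ∣ z → x ∣ y + z
  ∣-+ {x} (a , a*x≈y) (b , b*x≈z) = a + b , trans (distribʳ x a b) (+-cong a*x≈y b*x≈z)

  ∣-odd-multiple : ∀ {G} → Recurrent G → ∀ k → G k ∣ lucas k →
                   ∀ q → ¬ 2 ℕ.∣ q → G k ∣ G (k ℕ.* q)
  ∣-odd-multiple rec k Gk∣Lk zero          odd = contradiction (2 ℕ.∣0) odd
  ∣-odd-multiple {G} rec k Gk∣Lk (suc zero)    odd =
    ∣ʳ-reflexive (reflexive (≡.cong G (≡.sym (ℕ.*-identityʳ k))))
  ∣-odd-multiple {G} rec k Gk∣Lk (suc (suc q)) odd =
    ∣ʳ-respʳ-≈ (sym G[k*[2+q]]≈) (∣-+ (x∣ʳy⇒x∣ʳzy W Gk∣Lk) (x∣ʳy⇒x∣ʳzy (- c) Gk∣G[k*q]))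
    where
    c W : Poly
    c = (- g) ^ k
    W = G (k ℕ.+ k ℕ.* q)
    Gk∣G[k*q] : G k ∣ G (k ℕ.* q)
    Gk∣G[k*q] = ∣-odd-multiple rec k Gk∣Lk q (odd ∘ ℕ.∣m∣n⇒∣m+n (ℕ.∣-refl {2}))
    k*[2+q]≡k+k+k*q : k ℕ.* suc (suc q) ≡ k ℕ.+ k ℕ.+ k ℕ.* q
    k*[2+q]≡k+k+k*q = ≡.trans (ℕ.*-suc k (suc q))
      (≡.trans (≡.cong (k ℕ.+_) (ℕ.*-suc k q)) (≡.sym (ℕ.+-assoc k k (k ℕ.* q))))
    G[k*[2+q]]≈ : G (k ℕ.* suc (suc q)) ≈ W * lucas k + (- c) * G (k ℕ.* q)
    G[k*[2+q]]≈ = begin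
      G (k ℕ.* suc (suc q))                   ≈⟨ reflexive (≡.cong G k*[2+q]≡k+k+k*q) ⟩
      G (k ℕ.+ k ℕ.+ k ℕ.* q)
        ≈⟨ solve 3 (λ y c x → y ⊜ (y ⊕ c ⊗ x ⊕ (⊝ c) ⊗ x))
                   refl (G (k ℕ.+ k ℕ.+ k ℕ.* q)) c (G (k ℕ.* q)) ⟩
      G (k ℕ.+ k ℕ.+ k ℕ.* q) + c * G (k ℕ.* q) + (- c) * G (k ℕ.* q)
        ≈⟨ +-congʳ {(- c) * G (k ℕ.* q)} (lucas-product (shift-recurrent (k ℕ.* q) rec) k) ⟩
      lucas k * W + (- c) * G (k ℕ.* q)
        ≈⟨ +-congʳ {(- c) * G (k ℕ.* q)} (*-comm (lucas k) W) ⟩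
      W * lucas k + (- c) * G (k ℕ.* q)       ∎

  lucasType⇒GFP∣lucas : ∀ {p0 p1} → LucasType p0 p1 d g → ∀ n → GFP p0 p1 d g n ∣ lucas n
  lucasType⇒GFP∣lucas {p0} {p1} lucasType n = const c , trans (const-*ₚ c (G n)) (sym lucas≈cG)
    where
    open LucasType lucasType
    G : ℕ → Poly
    G = GFP p0 p1 d g
    p0∣2 : p0 ℤ.∣ + 2
    p0∣2 = [ (λ e → ∣ᵤ⇒∣ (≡.subst (ℕ._∣ 2) (≡.sym e) (ℕ.1∣ 2)))
           , (λ e → ∣ᵤ⇒∣ (≡.subst (ℕ._∣ 2) (≡.sym e) ℕ.∣-refl)) ] abs-p0
    c : ℤ.ℤ
    c = quotient p0∣2
    p0*lucas≈2*G : ∀ n → const p0 * lucas n ≈ (1# + 1#) * G n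
    p0*lucas≈2*G = recurrent-unique
      (*-recurrent (const p0) lucas-recurrent) (*-recurrent (1# + 1#) (GFP-recurrent p0 p1))
      (*-comm (const p0) (1# + 1#))
      (trans (const-*ₚ p0 d) (trans (sym (coeffwise two-p1)) (sym (const-*ₚ (+ 2) p1))))
    lucas≈cG : lucas n ≈ scale c (G n)
    lucas≈cG = scale-cancel {{≢-nonZero p0≠0}} p0∣2 (lucas n) (G n)
      (trans (sym (const-*ₚ p0 (lucas n))) (trans (p0*lucas≈2*G n) (const-*ₚ (+ 2) (G n))))

open import Data.Nat using (ℕ; _*_; _^_; NonZero)
open import Data.Nat.Divisibility using (_∣_)
open import Data.Integer using (ℤ)
open import Data.Product using (∃)
open import Relation.Binary.PropositionalEquality using (_≡_; refl)
open import Relation.Nullary using (¬_)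
open IntegerPolynomials using (∣⇒∣ₚ)

proposition9 : (p0 : ℤ) (p1 d g : Poly) → GFPData p0 p1 d g → LucasType p0 p1 d g →
    (m : ℕ) → NonZero m → ¬ (∃ λ k → m ≡ 2 ^ k) →
    (q k : ℕ) → ¬ (2 ∣ q) → m ≡ k * q →
    GFP p0 p1 d g k ∣ₚ GFP p0 p1 d g m
proposition9 p0 p1 d g _ lucasType _ _ _ q k q-odd refl =
  ∣⇒∣ₚ (∣-odd-multiple (GFP-recurrent p0 p1) k (lucasType⇒GFP∣lucas lucasType k) q q-odd)
  where open LinearRecurrences d g
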